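{- Let $\Sigma,\Gamma$ be finite alphabets with at least two letters each, $\mathcal{I}$ the set of injective morphisms $\Sigma^*\to\Gamma^*$, and $a,b\in\Sigma$ distinct letters. For a word $w\in\{a,b\}^+$ the following are equivalent: 1. $\mathrm{E}_{\mathcal{I}}(w)=\infty$. 2. $\mathrm{E}_{\mathcal{I}}(w)>|w|$. 3. There exist integers $k,j_1,j_2,j_3\ge 0$ such that $w=b^{j_1}(ab^{j_2})^k a b^{j_3}$ or $w=a^{j_1}(ba^{j_2})^k b a^{j_3}$.
   Context: For a nonempty word $v$ and natural number $p$, $v^{p/|v|}$ is the prefix of length $p$ of $vvv\cdots$. The fractional exponent of a nonempty word $u$ is $\mathrm{E}(u)=\sup\{r\in\mathbb{Q}\mid\exists v\ne\varepsilon: u=v^r\}$, and $\mathrm{E}_{\mathcal{I}}(u)=\sup\{\mathrm{E}(h(u))\mid h\in\mathcal{I}\}$. -}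

module Defs where

open import Data.Nat using (ℕ; _≤_)
open import Data.Fin using (Fin)
open import Data.List using (List; []; _∷_; _++_; length; take; concat; replicate; concatMap)
open import Data.List.Relation.Unary.All using (All)
open import Data.Integer using (+_)
open import Data.Rational using (ℚ; _/_; _*_; _<_)
open import Data.Product using (Σ; ∃; _×_)
open import Data.Sum using (_⊎_)
open import Relation.Binary.PropositionalEquality using (_≡_; _≢_)

Word : Set → Set
Word A = List A

ℕ→ℚ : ℕ → ℚ
ℕ→ℚ n = (+ n) / 1

-- v^{p/|v|}: the prefix of length p of vvv⋯ (for nonempty v; p copies of v
-- have length ≥ p, so the prefix is taken inside them).
prefixPow : {A : Set} → Word A → ℕ → Word A
prefixPow v p = take p (concat (replicate p v))

IsPowerOf : {A : Set} → Word A → Word A → ℚ → Set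
IsPowerOf u v r =
  (v ≢ []) × Σ ℕ (λ p → (r * ℕ→ℚ (length v) ≡ ℕ→ℚ p) × (u ≡ prefixPow v p))

Morphism : Set → Set → Set
Morphism Σ' Γ = Σ' → Word Γ

apply : {Σ' Γ : Set} → Morphism Σ' Γ → Word Σ' → Word Γ
apply h = concatMap h

InjectiveMorphism : {Σ' Γ : Set} → Morphism Σ' Γ → Set
InjectiveMorphism h = ∀ u v → apply h u ≡ apply h v → u ≡ v

-- "E(u) > q" unfolded from the sup definition.
ExpGreater : {A : Set} → Word A → ℚ → Set
ExpGreater u q = Σ (Word _) λ v → Σ ℚ λ r → IsPowerOf u v r × (q < r)

-- E_I(w) = ∞ : the supremum is unbounded.
EIInfinite : ∀ {n} (m : ℕ) → Word (Fin n) → Set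
EIInfinite {n} m w =
  ∀ (q : ℚ) → Σ (Morphism (Fin n) (Fin m)) λ h →
    InjectiveMorphism h × ExpGreater (apply h w) q

EIGreaterLength : ∀ {n} (m : ℕ) → Word (Fin n) → Set
EIGreaterLength {n} m w =
  Σ (Morphism (Fin n) (Fin m)) λ h →
    InjectiveMorphism h × ExpGreater (apply h w) (ℕ→ℚ (length w))

shape : {A : Set} → A → A → ℕ → ℕ → ℕ → ℕ → Word A
shape x y k j1 j2 j3 =
  replicate j1 x ++ concat (replicate k (y ∷ replicate j2 x)) ++ (y ∷ replicate j3 x)

HasShape : {A : Set} → A → A → Word A → Set
HasShape a b w = Σ ℕ λ k → Σ ℕ λ j1 → Σ ℕ λ j2 → Σ ℕ λ j3 →
  (w ≡ shape b a k j1 j2 j3) ⊎ (w ≡ shape a b k j1 j2 j3)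

-- (1 ⇒ 2) is immediate. (3 ⇒ 1): for w = y^j₁ (x y^j₂)^k x y^j₃, compose a prefix code
-- Σ → {0,1}* with a suffix code {0,1} → Γ* so that y ↦ 0 and x ↦ 0^T (1 0^{2T})^N 1 0^t with
-- t + j₂ = T; then every factor h(x) 0^j₂ 0^T closes up to a copy of 1 0^{2T}, h(w) is a prefix
-- of v^ω for a rotation v of 1 0^{2T}, and it contains at least N periods, N arbitrary.
-- (2 ⇒ 3): if h(w) = v^r with r > |w|, then |h(w)| > |w| |v|, so some letter x has |h(x)| ≥ |v|.
-- If w is not of the required shape with respect to x, two gaps between consecutive x's differ,
-- so h(w) contains both A B^i A and A B^i B B^k A with A = h(x), B = h(y). Comparing occurrences
-- of A modulo a period d ≤ |A| either yields a shorter period or shows that d divides |A| and |B|,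
-- in which case AB and BA occur at the same place; since h is injective, AB ≠ BA, so descending
-- on d leaves no period ≤ |A| at all, contradicting |v| ≤ |A|.

module Submission where

open import Defs
open import Data.Nat using (ℕ; _≤_)
open import Data.Fin using (Fin)
open import Data.List using (List; []; _∷_)
open import Data.List.Relation.Unary.All using (All)
open import Data.Product using (_×_)
open import Data.Sum using (_⊎_)
open import Function.Bundles using (_⇔_)
open import Relation.Binary.PropositionalEquality using (_≡_; _≢_)

open import Data.Bool.Base using (Bool; true; false)
open import Data.Empty using (⊥; ⊥-elim)
open import Data.Fin.Base using (zero; suc; toℕ)
open import Data.Fin.Properties using (toℕ-injective) renaming (_≟_ to _≟ᶠ_)
open import Data.Integer.Base as ℤ using (+<+; +≤+)
import Data.Integer.Properties as ℤ
open import Data.List using (_++_; [_]; _∷ʳ_; length; take; concat; replicate; concatMap; reverse)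
open import Data.List.Properties
  using (++-assoc; ++-identityʳ; ++-cancelˡ; ++-conicalˡ; ++-conicalʳ; length-++; length-++-≤ˡ; length-take;
         concatMap-++; reverse-++; reverse-involutive; reverse-injective; unfold-reverse;
         ∷-injectiveˡ; ∷-injectiveʳ; ∷ʳ-injectiveʳ)
open import Data.List.Relation.Unary.All as All using ([]; _∷_)
open import Data.Maybe using (Maybe; just; nothing)
open import Data.Nat.Base using (zero; suc; _+_; _*_; _∸_; _<_; z≤n; s≤s; NonZero; >-nonZero; >-nonZero⁻¹)
open import Data.Nat.Properties
open import Data.Nat.Coprimality using (1-coprimeTo) renaming (sym to coprime-sym)
open import Data.Nat.DivMod using (_%_; _/_; m≡m%n+[m/n]*n; m%n<n; m%n≤m; m%n%n≡m%n; %-distribˡ-+; [m+n]%n≡m%n; %-remove-+ʳ)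
open import Data.Nat.Divisibility using (_∣_; m%n≡0⇒n∣m; ∣⇒≤; ∣m+n∣m⇒∣n; ∣n⇒∣m*n)
open import Data.Nat.Induction using (<-wellFounded)
open import Data.Nat.Tactic.RingSolver using (solve-∀)
open import Data.Product using (∃; ∃₂; _,_; proj₁; proj₂)
open import Data.Rational.Base as ℚ using (ℚ; mkℚ; *<*; *≤*)
import Data.Rational.Properties as ℚ
open import Data.Sum using (inj₁; inj₂; [_,_]′)
open import Function.Base using (_∘_)
open import Function.Bundles using (mk⇔)
open import Induction.WellFounded using (Acc; acc)
open import Relation.Binary.Definitions using (tri<; tri≈; tri>)
open import Relation.Binary.PropositionalEquality using (refl; sym; trans; cong; cong₂; subst; subst₂; module ≡-Reasoning)
open import Relation.Nullary using (¬_; yes; no)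

module _ {d : ℕ} {{_ : NonZero d}} where

  +-preserves-%≡ : ∀ {i j} k → i % d ≡ j % d → (i + k) % d ≡ (j + k) % d
  +-preserves-%≡ {i} {j} k i≡j = begin
      (i + k) % d           ≡⟨ %-distribˡ-+ i k d ⟩
      (i % d + k % d) % d   ≡⟨ cong (λ z → (z + k % d) % d) i≡j ⟩
      (j % d + k % d) % d   ≡⟨ %-distribˡ-+ j k d ⟨
      (j + k) % d           ∎
    where open ≡-Reasoning

  +-%-complement : ∀ i {p} → p ≤ d → (p + (i + (d ∸ p)) % d) % d ≡ i % d
  +-%-complement i {p} p≤d = begin
      (p + i′ % d) % d          ≡⟨ %-distribˡ-+ p (i′ % d) d ⟩
      (p % d + i′ % d % d) % d  ≡⟨ cong (λ z → (p % d + z) % d) (m%n%n≡m%n i′ d) ⟩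
      (p % d + i′ % d) % d      ≡⟨ %-distribˡ-+ p i′ d ⟨
      (p + i′) % d              ≡⟨ cong (_% d) p+i′≡i+d ⟩
      (i + d) % d               ≡⟨ [m+n]%n≡m%n i d ⟩
      i % d                     ∎
    where
    open ≡-Reasoning
    i′ = i + (d ∸ p)
    p+i′≡i+d : p + i′ ≡ i + d
    p+i′≡i+d = trans (cong (p +_) (sym (+-∸-assoc i p≤d))) (m+[n∸m]≡n (≤-trans p≤d (m≤n+m d i)))

+-reassoc₅ : ∀ a b c d e → a + b + c + d + e ≡ a + (b + c + d + e)
+-reassoc₅ = solve-∀

+-swap₃ : ∀ a b c → a + b + c ≡ a + c + b
+-swap₃ = solve-∀

module _ {A : Set} where

  at : List A → ℕ → Maybe A
  at []       _       = nothing
  at (x ∷ xs) zero    = just x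
  at (x ∷ xs) (suc i) = at xs i

  at-++ʳ : ∀ (xs ys : List A) i → at (xs ++ ys) (length xs + i) ≡ at ys i
  at-++ʳ []       ys i = refl
  at-++ʳ (x ∷ xs) ys i = at-++ʳ xs ys i

  at-++ˡ : ∀ (xs ys : List A) {i} → i < length xs → at (xs ++ ys) i ≡ at xs i
  at-++ˡ (x ∷ xs) ys {zero}  _         = refl
  at-++ˡ (x ∷ xs) ys {suc i} (s≤s i<) = at-++ˡ xs ys i<

  at≡just⇒<length : ∀ (xs : List A) i {x} → at xs i ≡ just x → i < length xs
  at≡just⇒<length (y ∷ xs) zero    _  = s≤s z≤n
  at≡just⇒<length (y ∷ xs) (suc i) eq = s≤s (at≡just⇒<length xs i eq)

  <length⇒at≡just : ∀ (xs : List A) {i} → i < length xs → ∃ λ x → at xs i ≡ just x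
  <length⇒at≡just (x ∷ xs) {zero}  _        = x , refl
  <length⇒at≡just (x ∷ xs) {suc i} (s≤s i<) = <length⇒at≡just xs i<

  at-take : ∀ n (xs : List A) {i} → i < n → at (take n xs) i ≡ at xs i
  at-take (suc n) []       _        = refl
  at-take (suc n) (x ∷ xs) {zero}  _        = refl
  at-take (suc n) (x ∷ xs) {suc i} (s≤s i<) = at-take n xs i<

  at-injective : ∀ (xs ys : List A) → length xs ≡ length ys →
                 (∀ t → t < length xs → at xs t ≡ at ys t) → xs ≡ ys
  at-injective []       []       _   _  = refl
  at-injective (x ∷ xs) (y ∷ ys) len eq with eq zero (s≤s z≤n)
  ... | refl = cong (x ∷_) (at-injective xs ys (suc-injective len) (λ t t< → eq (suc t) (s≤s t<)))

  record OccursAt (u : List A) (p : ℕ) (X : List A) : Set where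
    constructor occursAt
    field at-occurrence : ∀ t → t < length X → at u (p + t) ≡ at X t
  open OccursAt public

  occursAt-middle : ∀ (x X y : List A) → OccursAt (x ++ X ++ y) (length x) X
  occursAt-middle x X y = occursAt λ t t< → trans (at-++ʳ x (X ++ y) t) (at-++ˡ X y t<)

  occursAt-++ˡ : ∀ {u p} (X Y : List A) → OccursAt u p (X ++ Y) → OccursAt u p X
  occursAt-++ˡ X Y o = occursAt λ t t< →
    trans (at-occurrence o t (<-≤-trans t< (length-++-≤ˡ X))) (at-++ˡ X Y t<)

  occursAt-++ʳ : ∀ {u p} (X Y : List A) → OccursAt u p (X ++ Y) → OccursAt u (p + length X) Y
  occursAt-++ʳ {u} {p} X Y o = occursAt λ t t< → begin
      at u (p + length X + t)   ≡⟨ cong (at u) (+-assoc p (length X) t) ⟩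
      at u (p + (length X + t)) ≡⟨ at-occurrence o (length X + t) (subst (length X + t <_) (sym (length-++ X)) (+-monoʳ-< (length X) t<)) ⟩
      at (X ++ Y) (length X + t) ≡⟨ at-++ʳ X Y t ⟩
      at Y t                    ∎
    where open ≡-Reasoning

  occursAt-++ : ∀ {u p} (X Y : List A) → OccursAt u p X → OccursAt u (p + length X) Y →
                OccursAt u p (X ++ Y)
  occursAt-++ {u} {p} X Y oX oY = occursAt occurrence
    where
    occurrence : ∀ t → t < length (X ++ Y) → at u (p + t) ≡ at (X ++ Y) t
    occurrence t t< with t <? length X
    ... | yes t<X = trans (at-occurrence oX t t<X) (sym (at-++ˡ X Y t<X))
    ... | no  t≮X = begin
        at u (p + t)                ≡⟨ cong (λ z → at u (p + z)) (sym t≡) ⟩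
        at u (p + (length X + s))   ≡⟨ cong (at u) (sym (+-assoc p (length X) s)) ⟩
        at u (p + length X + s)     ≡⟨ at-occurrence oY s s< ⟩
        at Y s                      ≡⟨ sym (at-++ʳ X Y s) ⟩
        at (X ++ Y) (length X + s)  ≡⟨ cong (at (X ++ Y)) t≡ ⟩
        at (X ++ Y) t               ∎
      where
      open ≡-Reasoning
      s = t ∸ length X
      t≡ : length X + s ≡ t
      t≡ = m+[n∸m]≡n (≮⇒≥ t≮X)
      s< : s < length Y
      s< = +-cancelˡ-< (length X) s (length Y) (subst₂ _<_ (sym t≡) (length-++ X) t<)

  occursAt⇒<length : ∀ {u p} (X : List A) {t} → t < length X → OccursAt u p X → p + t < length u
  occursAt⇒<length {u} {p} X {t} t< o with <length⇒at≡just X t<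
  ... | _ , eq = at≡just⇒<length u (p + t) (trans (at-occurrence o t t<) eq)

  occursAt⇒≤length : ∀ {u p} (X : List A) → 0 < length X → OccursAt u p X → p + length X ≤ length u
  occursAt⇒≤length {u} {p} X@(_ ∷ X′) _ o =
    subst (_≤ length u) (sym (+-suc p (length X′))) (occursAt⇒<length X (n<1+n (length X′)) o)

  occursAt-unique : ∀ {u p} (X Y : List A) → length X ≡ length Y →
                    OccursAt u p X → OccursAt u p Y → X ≡ Y
  occursAt-unique X Y len oX oY = at-injective X Y len λ t t< →
    trans (sym (at-occurrence oX t t<)) (at-occurrence oY t (subst (t <_) len t<))

  occursAt-copy : ∀ {u p q} (X Y : List A) → length Y ≤ length X →
                  OccursAt u p X → OccursAt u q X → OccursAt u p Y → OccursAt u q Y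
  occursAt-copy X Y Y≤X oX oX′ oY = occursAt λ t t< → let t<X = <-≤-trans t< Y≤X in
    trans (at-occurrence oX′ t t<X) (trans (sym (at-occurrence oX t t<X)) (at-occurrence oY t t<))

  record HasPeriod (u : List A) (d : ℕ) : Set where
    constructor hasPeriod
    field at-+period : ∀ i → i + d < length u → at u i ≡ at u (i + d)
  open HasPeriod public

  ShorterPeriod : List A → ℕ → Set
  ShorterPeriod u d = ∃ λ e → 0 < e × e < d × HasPeriod u e

  module Periodic {u : List A} {d : ℕ} {{_ : NonZero d}} (P : HasPeriod u d) where

    at-+multiple : ∀ i q → i + q * d < length u → at u i ≡ at u (i + q * d)
    at-+multiple i zero    _  = cong (at u) (sym (+-identityʳ i))
    at-+multiple i (suc q) i< = begin
        at u i               ≡⟨ at-+multiple i q (≤-<-trans (+-monoʳ-≤ i (m≤n+m (q * d) d)) i<) ⟩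
        at u (i + q * d)     ≡⟨ at-+period P (i + q * d) (subst (_< length u) i+ i<) ⟩
        at u (i + q * d + d) ≡⟨ cong (at u) (sym i+) ⟩
        at u (i + suc q * d) ∎
      where
      open ≡-Reasoning
      i+ : i + suc q * d ≡ i + q * d + d
      i+ = trans (cong (i +_) (+-comm d (q * d))) (sym (+-assoc i (q * d) d))

    at-% : ∀ i → i < length u → at u i ≡ at u (i % d)
    at-% i i< = sym (trans (at-+multiple (i % d) (i / d) (subst (_< length u) i≡ i<))
                           (cong (at u) (sym i≡)))
      where i≡ = m≡m%n+[m/n]*n i d

    at-≡-mod : ∀ {i j} → i % d ≡ j % d → i < length u → j < length u → at u i ≡ at u j
    at-≡-mod {i} {j} i≡j i< j< = trans (at-% i i<) (trans (cong (at u) i≡j) (sym (at-% j j<)))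

    occursAt-≡-mod : ∀ {p q} (X : List A) → OccursAt u q X → p % d ≡ q % d →
                     p + length X ≤ length u → OccursAt u p X
    occursAt-≡-mod {p} {q} X o p≡q p+X≤ = occursAt λ t t< →
      trans (at-≡-mod (+-preserves-%≡ {d = d} t p≡q) (<-≤-trans (+-monoʳ-< p t<) p+X≤) (occursAt⇒<length X t< o))
            (at-occurrence o t t<)

    shift-divisible-or-shorterPeriod :
      ∀ {p} δ (X : List A) → OccursAt u p X → OccursAt u (p + δ) X → d ≤ length X →
      d ∣ δ ⊎ ShorterPeriod u d
    shift-divisible-or-shorterPeriod {p} δ X o o′ d≤X with δ % d ≟ 0
    ... | yes δ%d≡0 = inj₁ (m%n≡0⇒n∣m δ d δ%d≡0)
    ... | no  δ%d≢0 = inj₂ (e , n≢0⇒n>0 δ%d≢0 , m%n<n δ d , hasPeriod period-e)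
      where
      e  = δ % d
      p₀ = p % d
      X>0 : 0 < length X
      X>0 = <-≤-trans (>-nonZero⁻¹ d) d≤X
      oₑ : OccursAt u p₀ X
      oₑ = occursAt-≡-mod X o (m%n%n≡m%n p d)
             (≤-trans (+-monoˡ-≤ (length X) (m%n≤m p d)) (occursAt⇒≤length X X>0 o))
      oₑ′ : OccursAt u (p₀ + e) X
      oₑ′ = occursAt-≡-mod X o′ (sym (%-distribˡ-+ p δ d))
              (≤-trans (+-monoˡ-≤ (length X) (+-mono-≤ (m%n≤m p d) (m%n≤m δ d)))
                       (occursAt⇒≤length X X>0 o′))
      -- Both occurrences of X span a full residue system mod d, so any i can be compared through X.
      period-e : ∀ i → i + e < length u → at u i ≡ at u (i + e)
      period-e i i+e< = begin
          at u i            ≡⟨ at-≡-mod (sym t≡i) (≤-<-trans (m≤m+n i e) i+e<) (occursAt⇒<length X t<X oₑ) ⟩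
          at u (p₀ + t)     ≡⟨ at-occurrence oₑ t t<X ⟩
          at X t            ≡⟨ at-occurrence oₑ′ t t<X ⟨
          at u (p₀ + e + t) ≡⟨ at-≡-mod shifted (occursAt⇒<length X t<X oₑ′) i+e< ⟩
          at u (i + e)      ∎
        where
        open ≡-Reasoning
        t = (i + (d ∸ p₀)) % d
        t≡i : (p₀ + t) % d ≡ i % d
        t≡i = +-%-complement {d = d} i (<⇒≤ (m%n<n p d))
        t<X : t < length X
        t<X = <-≤-trans (m%n<n (i + (d ∸ p₀)) d) d≤X
        shifted : (p₀ + e + t) % d ≡ (i + e) % d
        shifted = trans (cong (_% d) (+-swap₃ p₀ e t)) (+-preserves-%≡ {d = d} e t≡i)

module _ {A : Set} where

  infix 8 _^_
  _^_ : List A → ℕ → List A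
  B ^ n = concat (replicate n B)

  ^-+ : ∀ (B : List A) m n → B ^ (m + n) ≡ B ^ m ++ B ^ n
  ^-+ B zero    n = refl
  ^-+ B (suc m) n = trans (cong (B ++_) (^-+ B m n)) (sym (++-assoc B (B ^ m) (B ^ n)))

  ^-++-comm : ∀ (B : List A) k → B ^ k ++ B ≡ B ++ B ^ k
  ^-++-comm B k = begin
      B ^ k ++ B      ≡⟨ cong (B ^ k ++_) (++-identityʳ B) ⟨
      B ^ k ++ B ^ 1  ≡⟨ ^-+ B k 1 ⟨
      B ^ (k + 1)     ≡⟨ cong (B ^_) (+-comm k 1) ⟩
      B ^ suc k       ∎
    where open ≡-Reasoning

  length-^ : ∀ (B : List A) n → length (B ^ n) ≡ n * length B
  length-^ B zero    = refl
  length-^ B (suc n) = trans (length-++ B) (cong (length B +_) (length-^ B n))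

  ^-rotate : ∀ (X Y : List A) k → X ++ (Y ++ X) ^ k ≡ (X ++ Y) ^ k ++ X
  ^-rotate X Y zero    = ++-identityʳ X
  ^-rotate X Y (suc k) = begin
      X ++ (Y ++ X) ++ (Y ++ X) ^ k    ≡⟨ cong (X ++_) (++-assoc Y X _) ⟩
      X ++ Y ++ X ++ (Y ++ X) ^ k      ≡⟨ cong (λ z → X ++ Y ++ z) (^-rotate X Y k) ⟩
      X ++ Y ++ (X ++ Y) ^ k ++ X      ≡⟨ ++-assoc X Y _ ⟨
      (X ++ Y) ++ (X ++ Y) ^ k ++ X    ≡⟨ ++-assoc (X ++ Y) _ X ⟨
      ((X ++ Y) ++ (X ++ Y) ^ k) ++ X  ∎
    where open ≡-Reasoning

  singleton-^ : ∀ (a : A) n → [ a ] ^ n ≡ replicate n a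
  singleton-^ a zero    = refl
  singleton-^ a (suc n) = cong (a ∷_) (singleton-^ a n)

  take-hasPeriod : ∀ {u : List A} {d} n → HasPeriod u d → HasPeriod (take n u) d
  take-hasPeriod {u} {d} n P = hasPeriod λ i i+d< →
    let i+d<n = <-≤-trans i+d< (subst (_≤ n) (sym (length-take n u)) (m⊓n≤m n (length u))) in
    trans (at-take n u (≤-<-trans (m≤m+n i d) i+d<n))
          (trans (at-+period P i (<-≤-trans i+d< (length-take≤ n u))) (sym (at-take n u i+d<n)))
    where
    length-take≤ : ∀ n (u : List A) → length (take n u) ≤ length u
    length-take≤ n u = subst (_≤ length u) (sym (length-take n u)) (m⊓n≤n n (length u))

  ^-hasPeriod : ∀ (v : List A) n → HasPeriod (v ^ n) (length v)
  ^-hasPeriod v zero    = hasPeriod λ i ()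
  ^-hasPeriod v (suc n) = hasPeriod λ i i+v< → begin
      at (v ++ v ^ n) i              ≡⟨ cong (λ z → at z i) (^-++-comm v n) ⟨
      at (v ^ n ++ v) i              ≡⟨ at-++ˡ (v ^ n) v (i<vⁿ i+v<) ⟩
      at (v ^ n) i                   ≡⟨ at-++ʳ v (v ^ n) i ⟨
      at (v ++ v ^ n) (length v + i) ≡⟨ cong (at (v ++ v ^ n)) (+-comm (length v) i) ⟩
      at (v ++ v ^ n) (i + length v) ∎
    where
    open ≡-Reasoning
    i<vⁿ : ∀ {i} → i + length v < length (v ++ v ^ n) → i < length (v ^ n)
    i<vⁿ {i} i+v< = +-cancelˡ-< (length v) i _ (subst₂ _<_ (+-comm i (length v)) (length-++ v) i+v<)

  length>0 : ∀ {v : List A} → v ≢ [] → 0 < length v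
  length>0 {[]}    v≢[] = ⊥-elim (v≢[] refl)
  length>0 {_ ∷ _} _    = s≤s z≤n

  length-prefixPow : ∀ (v : List A) p → 0 < length v → length (prefixPow v p) ≡ p
  length-prefixPow v p v>0 = trans (length-take p (v ^ p))
    (m≤n⇒m⊓n≡m (subst (p ≤_) (sym (length-^ v p)) (m≤m*n p (length v) {{>-nonZero v>0}})))

  prefixPow-hasPeriod : ∀ (v : List A) p → HasPeriod (prefixPow v p) (length v)
  prefixPow-hasPeriod v p = take-hasPeriod p (^-hasPeriod v p)

  replicate-+-++ : ∀ (c : A) a b R → replicate a c ++ replicate b c ++ R ≡ replicate (a + b) c ++ R
  replicate-+-++ c zero    b R = refl
  replicate-+-++ c (suc a) b R = cong (c ∷_) (replicate-+-++ c a b R)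

  replicate-+ : ∀ (c : A) a b → replicate a c ++ replicate b c ≡ replicate (a + b) c
  replicate-+ c zero    b = refl
  replicate-+ c (suc a) b = cong (c ∷_) (replicate-+ c a b)

  take-length-++ : ∀ (xs ys : List A) → take (length xs) (xs ++ ys) ≡ xs
  take-length-++ []       ys = refl
  take-length-++ (x ∷ xs) ys = cong (x ∷_) (take-length-++ xs ys)

  take-++-≤ : ∀ n (xs ys : List A) → n ≤ length xs → take n (xs ++ ys) ≡ take n xs
  take-++-≤ zero    xs       ys _         = refl
  take-++-≤ (suc n) (x ∷ xs) ys (s≤s n≤) = cong (x ∷_) (take-++-≤ n xs ys n≤)

  prefix-of-^⇒prefixPow : ∀ (v : List A) → 0 < length v → ∀ xs R M → xs ++ R ≡ v ^ M →
                          prefixPow v (length xs) ≡ xs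
  prefix-of-^⇒prefixPow v v>0 xs R M xs++R≡ = begin
      take n (v ^ n)            ≡⟨ take-++-≤ n (v ^ n) (v ^ M) n≤|vⁿ| ⟨
      take n (v ^ n ++ v ^ M)   ≡⟨ cong (take n) ^-swap ⟩
      take n (v ^ M ++ v ^ n)   ≡⟨ take-++-≤ n (v ^ M) (v ^ n) n≤|vᴹ| ⟩
      take n (v ^ M)            ≡⟨ cong (take n) xs++R≡ ⟨
      take n (xs ++ R)          ≡⟨ take-length-++ xs R ⟩
      xs                        ∎
    where
    open ≡-Reasoning
    n = length xs
    n≤|vⁿ| : n ≤ length (v ^ n)
    n≤|vⁿ| = subst (n ≤_) (sym (length-^ v n)) (m≤m*n n (length v) {{>-nonZero v>0}})
    n≤|vᴹ| : n ≤ length (v ^ M)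
    n≤|vᴹ| = subst (n ≤_) (trans (sym (length-++ xs)) (cong length xs++R≡)) (m≤m+n n (length R))
    ^-swap : v ^ n ++ v ^ M ≡ v ^ M ++ v ^ n
    ^-swap = trans (sym (^-+ v n M)) (trans (cong (v ^_) (+-comm n M)) (^-+ v M n))

-- Two different gaps exclude a short period

module TwoGapFactors {C : Set} {A B : List C} (AB≢BA : A ++ B ≢ B ++ A) (B≢[] : 0 < length B)
               {u : List C} {i k p₁ p₂ : ℕ}
               (o₁ : OccursAt u p₁ (A ++ B ^ i ++ A))
               (o₂ : OccursAt u p₂ (A ++ B ^ i ++ B ++ B ^ k ++ A)) where

  α = length A
  β = length B
  bᵢ = length (B ^ i)
  bₖ = length (B ^ k)

  -- The second factor is read as A at p₂, B at S, B ^ k at S + β and A at Q.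
  S Q : ℕ
  S = p₂ + α + bᵢ
  Q = S + β + bₖ

  A-at-p₁ : OccursAt u p₁ A
  A-at-p₁ = occursAt-++ˡ A _ o₁

  A-at-p₁+α+bᵢ : OccursAt u (p₁ + (α + bᵢ)) A
  A-at-p₁+α+bᵢ = subst (λ q → OccursAt u q A) (+-assoc p₁ α bᵢ)
                   (occursAt-++ʳ (B ^ i) A (occursAt-++ʳ A _ o₁))

  A-at-p₂ : OccursAt u p₂ A
  A-at-p₂ = occursAt-++ˡ A _ o₂

  BBᵏA-at-S : OccursAt u S (B ++ B ^ k ++ A)
  BBᵏA-at-S = occursAt-++ʳ (B ^ i) _ (occursAt-++ʳ A _ o₂)

  B-at-S : OccursAt u S B
  B-at-S = occursAt-++ˡ B _ BBᵏA-at-S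

  Bᵏ-at-S+β : OccursAt u (S + β) (B ^ k)
  Bᵏ-at-S+β = occursAt-++ˡ (B ^ k) A (occursAt-++ʳ B _ BBᵏA-at-S)

  A-at-Q : OccursAt u Q A
  A-at-Q = occursAt-++ʳ (B ^ k) A (occursAt-++ʳ B _ BBᵏA-at-S)

  module _ {d : ℕ} {{_ : NonZero d}} (P : HasPeriod u d) (d≤α : d ≤ α) where
    open Periodic P

    Q+α≤ : Q + α ≤ length u
    Q+α≤ = occursAt⇒≤length A (<-≤-trans (>-nonZero⁻¹ d) d≤α) A-at-Q

    A-at-S : d ∣ β + bₖ → OccursAt u S A
    A-at-S d∣β+bₖ = occursAt-≡-mod A A-at-Q (sym Q%d≡S%d)
                      (≤-trans (+-monoˡ-≤ α (m≤m+n S (β + bₖ))) (subst (λ q → q + α ≤ length u) Q≡ Q+α≤))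
      where
      Q≡ : Q ≡ S + (β + bₖ)
      Q≡ = +-assoc S β bₖ
      Q%d≡S%d : Q % d ≡ S % d
      Q%d≡S%d = trans (cong (_% d) Q≡) (%-remove-+ʳ S d∣β+bₖ)

    d∣β-or-shorter : d ∣ β + bₖ → d ∣ β ⊎ ShorterPeriod u d
    d∣β-or-shorter d∣β+bₖ with β ≤? α
    ... | yes β≤α =
      shift-divisible-or-shorterPeriod β (B ++ B ^ k) BBᵏ-at-S BᵏB-at-S+β
        (subst (d ≤_) (sym (length-++ B)) (∣⇒≤ {{>-nonZero (<-≤-trans B≢[] (m≤m+n β bₖ))}} d∣β+bₖ))
      where
      B-at-Q : OccursAt u Q B
      B-at-Q = occursAt-copy A B β≤α (A-at-S d∣β+bₖ) A-at-Q B-at-S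
      BBᵏ-at-S : OccursAt u S (B ++ B ^ k)
      BBᵏ-at-S = occursAt-++ B (B ^ k) B-at-S Bᵏ-at-S+β
      BᵏB-at-S+β : OccursAt u (S + β) (B ++ B ^ k)
      BᵏB-at-S+β = subst (OccursAt u (S + β)) (^-++-comm B k) (occursAt-++ (B ^ k) B Bᵏ-at-S+β B-at-Q)
    ... | no  β≰α = long k Bᵏ-at-S+β d∣β+bₖ
      where
      long : ∀ j → OccursAt u (S + β) (B ^ j) → d ∣ β + length (B ^ j) → d ∣ β ⊎ ShorterPeriod u d
      long zero    _ d∣β+0 = inj₁ (subst (d ∣_) (+-identityʳ β) d∣β+0)
      long (suc j) o _     = shift-divisible-or-shorterPeriod β B B-at-S (occursAt-++ˡ B (B ^ j) o)
                               (≤-trans d≤α (<⇒≤ (≰⇒> β≰α)))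

    -- Once d divides |A| and |B|, periodicity moves A to S + β and B to S + α, so AB = BA.
    ¬d∣β : d ∣ α + bᵢ → d ∣ β + bₖ → d ∣ β → ⊥
    ¬d∣β d∣α+bᵢ d∣β+bₖ d∣β = AB≢BA (occursAt-unique (A ++ B) (B ++ A) length-AB≡BA AB-at-S BA-at-S)
      where
      d∣α : d ∣ α
      d∣α = ∣m+n∣m⇒∣n (subst (d ∣_) (+-comm α bᵢ) d∣α+bᵢ)
                      (subst (d ∣_) (sym (length-^ B i)) (∣n⇒∣m*n i d∣β))
      S+β+α≤ : S + β + α ≤ length u
      S+β+α≤ = ≤-trans (+-monoˡ-≤ α (m≤m+n (S + β) bₖ)) Q+α≤
      A-at-S+β : OccursAt u (S + β) A
      A-at-S+β = occursAt-≡-mod A (A-at-S d∣β+bₖ) (%-remove-+ʳ S d∣β) S+β+α≤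
      B-at-S+α : OccursAt u (S + α) B
      B-at-S+α = occursAt-≡-mod B B-at-S (%-remove-+ʳ S d∣α) (subst (_≤ length u) (+-swap₃ S β α) S+β+α≤)
      AB-at-S : OccursAt u S (A ++ B)
      AB-at-S = occursAt-++ A B (A-at-S d∣β+bₖ) B-at-S+α
      BA-at-S : OccursAt u S (B ++ A)
      BA-at-S = occursAt-++ B A B-at-S A-at-S+β
      length-AB≡BA : length (A ++ B) ≡ length (B ++ A)
      length-AB≡BA = trans (length-++ A) (trans (+-comm α β) (sym (length-++ B)))

    -- Each step of the argument either exhibits a shorter period or yields a divisibility by d.
    _>>=_ : {D : Set} → D ⊎ ShorterPeriod u d → (D → ShorterPeriod u d) → ShorterPeriod u d
    inj₁ divides >>= continue = continue divides
    inj₂ shorter >>= _        = shorter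

    shorterPeriod : ShorterPeriod u d
    shorterPeriod = do
      d∣α+bᵢ ← shift-divisible-or-shorterPeriod (α + bᵢ) A A-at-p₁ A-at-p₁+α+bᵢ d≤α
      d∣α+bᵢ+β+bₖ ← shift-divisible-or-shorterPeriod (α + bᵢ + β + bₖ) A A-at-p₂
                       (subst (λ q → OccursAt u q A) (+-reassoc₅ p₂ α bᵢ β bₖ) A-at-Q) d≤α
      let d∣β+bₖ = ∣m+n∣m⇒∣n (subst (d ∣_) (+-assoc (α + bᵢ) β bₖ) d∣α+bᵢ+β+bₖ) d∣α+bᵢ
      d∣β ← d∣β-or-shorter d∣β+bₖ
      ⊥-elim (¬d∣β d∣α+bᵢ d∣β+bₖ d∣β)

twoGaps⇒noPeriod≤ :
  ∀ {C : Set} {u : List C} (A B : List C) (i k : ℕ) {p₁ p₂} →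
  A ++ B ≢ B ++ A → 0 < length B →
  OccursAt u p₁ (A ++ B ^ i ++ A) → OccursAt u p₂ (A ++ B ^ i ++ B ++ B ^ k ++ A) →
  ∀ {d} → 0 < d → HasPeriod u d → ¬ d ≤ length A
twoGaps⇒noPeriod≤ {u = u} A B i k AB≢BA B≢[] o₁ o₂ {d} d>0 P = descend d (<-wellFounded d) d>0 P
  where
  open TwoGapFactors {A = A} {B} AB≢BA B≢[] {i = i} {k} o₁ o₂
  descend : ∀ d → Acc _<_ d → 0 < d → HasPeriod u d → ¬ d ≤ length A
  descend (suc d) (acc rec) _ P d≤α with shorterPeriod P d≤α
  ... | e , e>0 , e<d , Pₑ = descend e (rec e<d) e>0 Pₑ (≤-trans (<⇒≤ e<d) d≤α)

HasShape-swap : ∀ {A : Set} {a b : A} {w} → HasShape a b w → HasShape b a w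
HasShape-swap (k , j₁ , j₂ , j₃ , inj₁ eq) = k , j₁ , j₂ , j₃ , inj₂ eq
HasShape-swap (k , j₁ , j₂ , j₃ , inj₂ eq) = k , j₁ , j₂ , j₃ , inj₁ eq

module BinaryWords {A : Set} (x y : A) where

  InXY : A → Set
  InXY z = z ≡ x ⊎ z ≡ y

  y^ : ℕ → List A
  y^ n = replicate n y

  y^-∷ : ∀ n (s : List A) → y^ n ++ y ∷ s ≡ y ∷ y^ n ++ s
  y^-∷ zero    s = refl
  y^-∷ (suc n) s = cong (y ∷_) (y^-∷ n s)

  y^-split : ∀ {i j} → i < j → y^ j ≡ y^ i ++ y ∷ y^ (j ∸ suc i)
  y^-split {zero}  {suc j} _        = refl
  y^-split {suc i} {suc j} (s≤s i<j) = cong (y ∷_) (y^-split i<j)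

  split-y-prefix : ∀ w → All InXY w →
    (∃ λ n → w ≡ y^ n) ⊎ (∃₂ λ j w′ → w ≡ y^ j ++ x ∷ w′ × All InXY w′)
  split-y-prefix []      []                 = inj₁ (0 , refl)
  split-y-prefix (_ ∷ w) (inj₁ refl ∷ xy-w) = inj₂ (0 , w , refl , xy-w)
  split-y-prefix (_ ∷ w) (inj₂ refl ∷ xy-w) with split-y-prefix w xy-w
  ... | inj₁ (n , eq)            = inj₁ (suc n , cong (y ∷_) eq)
  ... | inj₂ (j , w′ , eq , xy′) = inj₂ (suc j , w′ , cong (y ∷_) eq , xy′)

  GapOtherThan : ℕ → List A → Set
  GapOtherThan g w = ∃ λ g′ → g′ ≢ g × ∃₂ λ p s → w ≡ p ++ x ∷ y^ g′ ++ x ∷ s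

  TwoGaps : List A → Set
  TwoGaps w = ∃₂ λ i k → (∃₂ λ p s → w ≡ p ++ x ∷ y^ i ++ x ∷ s)
                       × (∃₂ λ p s → w ≡ p ++ x ∷ (y^ i ++ y ∷ y^ k) ++ x ∷ s)

  -- The counter c records the letters y read since the last x.
  blocks-or-gap : ∀ g c s → All InXY s →
    (∃₂ λ k j → y^ c ++ s ≡ (y^ g ++ [ x ]) ^ k ++ y^ j) ⊎ GapOtherThan g (x ∷ y^ c ++ s)
  blocks-or-gap g c []      []                 = inj₁ (0 , c , ++-identityʳ _)
  blocks-or-gap g c (_ ∷ s) (inj₂ refl ∷ xy-s) with blocks-or-gap g (suc c) s xy-s
  ... | inj₁ (k , j , eq)                = inj₁ (k , j , trans (y^-∷ c s) eq)
  ... | inj₂ (g′ , g′≢g , p , s′ , eq)   = inj₂ (g′ , g′≢g , p , s′ , trans (cong (x ∷_) (y^-∷ c s)) eq)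
  blocks-or-gap g c (_ ∷ s) (inj₁ refl ∷ xy-s) with c ≟ g
  ... | no  c≢g = inj₂ (c , c≢g , [] , s , refl)
  ... | yes refl with blocks-or-gap c 0 s xy-s
  ...   | inj₁ (k , j , eq) = inj₁ (suc k , j , (begin
      y^ c ++ x ∷ s                                   ≡⟨ cong (λ z → y^ c ++ x ∷ z) eq ⟩
      y^ c ++ x ∷ (y^ c ++ [ x ]) ^ k ++ y^ j        ≡⟨ ++-assoc (y^ c) [ x ] _ ⟨
      (y^ c ++ [ x ]) ++ (y^ c ++ [ x ]) ^ k ++ y^ j ≡⟨ ++-assoc (y^ c ++ [ x ]) _ (y^ j) ⟨
      (y^ c ++ [ x ]) ^ suc k ++ y^ j                 ∎))
    where open ≡-Reasoning
  ...   | inj₂ (g′ , g′≢g , p , s′ , eq) =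
    inj₂ (g′ , g′≢g , x ∷ y^ c ++ p , s′ , cong (x ∷_) (trans (cong (y^ c ++_) eq) (sym (++-assoc (y^ c) p _))))

  x∷blocks : ∀ g k R → x ∷ (y^ g ++ [ x ]) ^ k ++ R ≡ (x ∷ y^ g) ^ k ++ x ∷ R
  x∷blocks g k R = begin
      x ∷ (y^ g ++ [ x ]) ^ k ++ R      ≡⟨ ++-assoc [ x ] _ R ⟨
      ([ x ] ++ (y^ g ++ [ x ]) ^ k) ++ R ≡⟨ cong (_++ R) (^-rotate [ x ] (y^ g) k) ⟩
      ((x ∷ y^ g) ^ k ++ [ x ]) ++ R      ≡⟨ ++-assoc ((x ∷ y^ g) ^ k) [ x ] R ⟩
      (x ∷ y^ g) ^ k ++ x ∷ R           ∎
    where open ≡-Reasoning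

  two-different-gaps : ∀ {w} g g′ → g′ ≢ g →
    (∃₂ λ p s → w ≡ p ++ x ∷ y^ g ++ x ∷ s) → (∃₂ λ p s → w ≡ p ++ x ∷ y^ g′ ++ x ∷ s) → TwoGaps w
  two-different-gaps g g′ g′≢g (p , s , eq) (p′ , s′ , eq′) with <-cmp g g′
  ... | tri< g<g′ _ _ = g , g′ ∸ suc g , (p , s , eq) ,
                        (p′ , s′ , trans eq′ (cong (λ z → p′ ++ x ∷ z ++ x ∷ s′) (y^-split g<g′)))
  ... | tri≈ _ g≡g′ _ = ⊥-elim (g′≢g (sym g≡g′))
  ... | tri> _ _ g>g′ = g′ , g ∸ suc g′ , (p′ , s′ , eq′) ,
                        (p , s , trans eq (cong (λ z → p ++ x ∷ z ++ x ∷ s) (y^-split g>g′)))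

  two-xs⇒hasShape-or-twoGaps : ∀ {w} j₁ g w″ → w ≡ y^ j₁ ++ x ∷ y^ g ++ x ∷ w″ → All InXY w″ →
                               HasShape x y w ⊎ TwoGaps w
  two-xs⇒hasShape-or-twoGaps {w} j₁ g w″ w≡ xy-w″ with blocks-or-gap g 0 w″ xy-w″
  ... | inj₁ (k , j₃ , w″≡) = inj₁ (suc k , j₁ , g , j₃ , inj₁ (begin
      w                                                     ≡⟨ w≡ ⟩
      y^ j₁ ++ x ∷ y^ g ++ x ∷ w″                           ≡⟨ cong (λ z → y^ j₁ ++ x ∷ y^ g ++ x ∷ z) w″≡ ⟩
      y^ j₁ ++ x ∷ y^ g ++ x ∷ (y^ g ++ [ x ]) ^ k ++ y^ j₃  ≡⟨ cong (λ z → y^ j₁ ++ x ∷ y^ g ++ z) (x∷blocks g k (y^ j₃)) ⟩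
      y^ j₁ ++ x ∷ y^ g ++ (x ∷ y^ g) ^ k ++ x ∷ y^ j₃     ≡⟨ cong (λ z → y^ j₁ ++ x ∷ z) (++-assoc (y^ g) _ _) ⟨
      shape y x (suc k) j₁ g j₃                              ∎))
    where open ≡-Reasoning
  ... | inj₂ (g′ , g′≢g , p , s , w″≡) =
    inj₂ (two-different-gaps g g′ g′≢g (y^ j₁ , w″ , w≡) (y^ j₁ ++ x ∷ y^ g ++ p , s , (begin
      w                                            ≡⟨ w≡ ⟩
      y^ j₁ ++ x ∷ y^ g ++ x ∷ w″                  ≡⟨ cong (λ z → y^ j₁ ++ x ∷ y^ g ++ z) w″≡ ⟩
      y^ j₁ ++ x ∷ y^ g ++ p ++ rest               ≡⟨ cong (λ z → y^ j₁ ++ x ∷ z) (++-assoc (y^ g) p _) ⟨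
      y^ j₁ ++ (x ∷ y^ g ++ p) ++ rest             ≡⟨ ++-assoc (y^ j₁) (x ∷ y^ g ++ p) _ ⟨
      (y^ j₁ ++ x ∷ y^ g ++ p) ++ rest             ∎)))
    where
    open ≡-Reasoning
    rest = x ∷ y^ g′ ++ x ∷ s

  hasShape-or-twoGaps : ∀ w → w ≢ [] → All InXY w → HasShape x y w ⊎ TwoGaps w
  hasShape-or-twoGaps w w≢[] xy-w with split-y-prefix w xy-w
  ... | inj₁ (zero  , w≡) = ⊥-elim (w≢[] w≡)
  ... | inj₁ (suc n , w≡) = inj₁ (n , 0 , 0 , 0 , inj₂ (trans w≡ y^1+n≡))
    where
    y^1+n≡ : y^ (suc n) ≡ [ y ] ^ n ++ [ y ]
    y^1+n≡ = sym (trans (^-++-comm [ y ] n) (cong (y ∷_) (singleton-^ y n)))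
  ... | inj₂ (j₁ , w′ , w≡ , xy-w′) with split-y-prefix w′ xy-w′
  ...   | inj₁ (n , w′≡) = inj₁ (0 , j₁ , 0 , n , inj₁ (trans w≡ (cong (λ z → y^ j₁ ++ x ∷ z) w′≡)))
  ...   | inj₂ (g , w″ , w′≡ , xy-w″) =
    two-xs⇒hasShape-or-twoGaps j₁ g w″ (trans w≡ (cong (λ z → y^ j₁ ++ x ∷ z) w′≡)) xy-w″

module _ {X A : Set} (h : Morphism X A) where

  apply-replicate : ∀ i z → apply h (replicate i z) ≡ h z ^ i
  apply-replicate zero    z = refl
  apply-replicate (suc i) z = cong (h z ++_) (apply-replicate i z)

  apply-^ : ∀ (W : List X) k → apply h (W ^ k) ≡ apply h W ^ k
  apply-^ W zero    = refl
  apply-^ W (suc k) = trans (concatMap-++ h W _) (cong (apply h W ++_) (apply-^ W k))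

  length-apply≤ : ∀ {c} (w : List X) → All (λ z → length (h z) ≤ c) w → length (apply h w) ≤ length w * c
  length-apply≤ []      []          = z≤n
  length-apply≤ (z ∷ w) (hz≤ ∷ w≤) = subst (_≤ _) (sym (length-++ (h z))) (+-mono-≤ hz≤ (length-apply≤ w w≤))

  apply-factor : ∀ p z (m : List X) z′ s →
                 apply h (p ++ z ∷ m ++ z′ ∷ s) ≡ apply h p ++ (h z ++ apply h m ++ h z′) ++ apply h s
  apply-factor p z m z′ s = begin
      apply h (p ++ z ∷ m ++ z′ ∷ s)                        ≡⟨ concatMap-++ h p _ ⟩
      apply h p ++ h z ++ apply h (m ++ z′ ∷ s)             ≡⟨ cong (λ q → apply h p ++ h z ++ q) (concatMap-++ h m _) ⟩
      apply h p ++ h z ++ apply h m ++ h z′ ++ apply h s    ≡⟨ cong (λ q → apply h p ++ h z ++ q) (++-assoc (apply h m) (h z′) _) ⟨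
      apply h p ++ h z ++ (apply h m ++ h z′) ++ apply h s  ≡⟨ cong (apply h p ++_) (++-assoc (h z) _ _) ⟨
      apply h p ++ (h z ++ apply h m ++ h z′) ++ apply h s  ∎
    where open ≡-Reasoning

module _ {A : Set} where

  ++-prefixes-comparable : ∀ (xs ys xs′ ys′ : List A) → xs ++ ys ≡ xs′ ++ ys′ →
                           (∃ λ s → xs ++ s ≡ xs′) ⊎ (∃ λ s → xs′ ++ s ≡ xs)
  ++-prefixes-comparable []       ys xs′       ys′ _  = inj₁ (xs′ , refl)
  ++-prefixes-comparable (x ∷ xs) ys []        ys′ _  = inj₂ (x ∷ xs , refl)
  ++-prefixes-comparable (x ∷ xs) ys (x′ ∷ xs′) ys′ eq
    with refl ← ∷-injectiveˡ eq | ++-prefixes-comparable xs ys xs′ ys′ (∷-injectiveʳ eq)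
  ... | inj₁ (s , e) = inj₁ (s , cong (x ∷_) e)
  ... | inj₂ (s , e) = inj₂ (s , cong (x ∷_) e)

module _ {X A : Set} (f : Morphism X A) where

  PrefixFree SuffixFree : Set
  PrefixFree = ∀ z z′ s → f z ++ s ≡ f z′ → z ≡ z′
  SuffixFree = ∀ z z′ s → s ++ f z ≡ f z′ → z ≡ z′

  prefixFree-head : PrefixFree → ∀ {z z′} U V → f z ++ U ≡ f z′ ++ V → z ≡ z′
  prefixFree-head pf {z} {z′} U V eq with ++-prefixes-comparable (f z) U (f z′) V eq
  ... | inj₁ (s , e) = pf z z′ s e
  ... | inj₂ (s , e) = sym (pf z′ z s e)

  prefixCode⇒injective : (∀ z → f z ≢ []) → PrefixFree → InjectiveMorphism f
  prefixCode⇒injective ne pf []      []       _  = refl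
  prefixCode⇒injective ne pf []      (z ∷ v)  eq = ⊥-elim (ne z (++-conicalˡ (f z) _ (sym eq)))
  prefixCode⇒injective ne pf (z ∷ u) []       eq = ⊥-elim (ne z (++-conicalˡ (f z) _ eq))
  prefixCode⇒injective ne pf (z ∷ u) (z′ ∷ v) eq with refl ← prefixFree-head pf _ _ eq =
    cong (z ∷_) (prefixCode⇒injective ne pf u v (++-cancelˡ (f z) _ _ eq))

  reverse-apply : ∀ u → reverse (apply f u) ≡ apply (reverse ∘ f) (reverse u)
  reverse-apply []      = refl
  reverse-apply (z ∷ u) = begin
      reverse (f z ++ apply f u)                               ≡⟨ reverse-++ (f z) (apply f u) ⟩
      reverse (apply f u) ++ reverse (f z)                     ≡⟨ cong (_++ reverse (f z)) (reverse-apply u) ⟩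
      apply (reverse ∘ f) (reverse u) ++ reverse (f z)         ≡⟨ cong (apply (reverse ∘ f) (reverse u) ++_) (++-identityʳ (reverse (f z))) ⟨
      apply (reverse ∘ f) (reverse u) ++ apply (reverse ∘ f) [ z ] ≡⟨ concatMap-++ (reverse ∘ f) (reverse u) [ z ] ⟨
      apply (reverse ∘ f) (reverse u ∷ʳ z)                     ≡⟨ cong (apply (reverse ∘ f)) (unfold-reverse z u) ⟨
      apply (reverse ∘ f) (reverse (z ∷ u))                    ∎
    where open ≡-Reasoning

suffixCode⇒injective : ∀ {X A : Set} (f : Morphism X A) → (∀ z → f z ≢ []) → SuffixFree f → InjectiveMorphism f
suffixCode⇒injective f ne sf u v eq = reverse-injective
  (prefixCode⇒injective (reverse ∘ f) ne′ pf (reverse u) (reverse v)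
    (trans (sym (reverse-apply f u)) (trans (cong reverse eq) (reverse-apply f v))))
  where
  ne′ : ∀ z → reverse (f z) ≢ []
  ne′ z e = ne z (trans (sym (reverse-involutive (f z))) (cong reverse e))
  pf : PrefixFree (reverse ∘ f)
  pf z z′ s e = sf z z′ (reverse s) (begin
      reverse s ++ f z                     ≡⟨ cong (reverse s ++_) (reverse-involutive (f z)) ⟨
      reverse s ++ reverse (reverse (f z)) ≡⟨ reverse-++ (reverse (f z)) s ⟨
      reverse (reverse (f z) ++ s)         ≡⟨ cong reverse e ⟩
      reverse (reverse (f z′))             ≡⟨ reverse-involutive (f z′) ⟩
      f z′                                 ∎)
    where open ≡-Reasoning

apply-∘ : ∀ {X Y A : Set} (f : Morphism Y A) (g : Morphism X Y) u →
          apply (apply f ∘ g) u ≡ apply f (apply g u)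
apply-∘ f g []      = refl
apply-∘ f g (z ∷ u) = trans (cong (apply f (g z) ++_) (apply-∘ f g u)) (sym (concatMap-++ f (g z) (apply g u)))

injective-∘ : ∀ {X Y A : Set} {f : Morphism Y A} {g : Morphism X Y} →
              InjectiveMorphism f → InjectiveMorphism g → InjectiveMorphism (apply f ∘ g)
injective-∘ {f = f} {g} f-inj g-inj u v eq =
  g-inj u v (f-inj (apply g u) (apply g v) (trans (sym (apply-∘ f g u)) (trans eq (apply-∘ f g v))))

-- ℕ→ℚ n does not compute (it normalises by a gcd), so we compare it with the literal
-- normal form, on which the ordering and the positivity instances reduce.
ℕ→ℚ′ : ℕ → ℚ
ℕ→ℚ′ n = mkℚ (ℤ.+ n) 0 (coprime-sym (1-coprimeTo n))

ℕ→ℚ≡ℕ→ℚ′ : ∀ n → ℕ→ℚ n ≡ ℕ→ℚ′ n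
ℕ→ℚ≡ℕ→ℚ′ n = ℚ.normalize-coprime (coprime-sym (1-coprimeTo n))

ℕ→ℚ′-* : ∀ a b → ℕ→ℚ′ a ℚ.* ℕ→ℚ′ b ≡ ℕ→ℚ′ (a * b)
ℕ→ℚ′-* zero    b       = ℚ.normalize-coprime (coprime-sym (1-coprimeTo 0))
ℕ→ℚ′-* (suc a) zero    = trans (ℚ.*-zeroʳ (ℕ→ℚ′ (suc a))) (cong ℕ→ℚ′ (sym (*-zeroʳ (suc a))))
ℕ→ℚ′-* (suc a) (suc b) = ℚ.normalize-coprime (coprime-sym (1-coprimeTo (suc a * suc b)))

ℕ→ℚ′-cancel-< : ∀ {a b} → ℕ→ℚ′ a ℚ.< ℕ→ℚ′ b → a < b
ℕ→ℚ′-cancel-< {a} {b} (*<* a<b) = ℤ.drop‿+<+ (subst₂ ℤ._<_ (ℤ.*-identityʳ (ℤ.+ a)) (ℤ.*-identityʳ (ℤ.+ b)) a<b)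

ℕ→ℚ′-mono-≤ : ∀ {a b} → a ≤ b → ℕ→ℚ′ a ℚ.≤ ℕ→ℚ′ b
ℕ→ℚ′-mono-≤ {a} {b} a≤b = *≤* (subst₂ ℤ._≤_ (sym (ℤ.*-identityʳ (ℤ.+ a))) (sym (ℤ.*-identityʳ (ℤ.+ b))) (+≤+ a≤b))

exponent>⇒length> : ∀ (w : ℕ) {L p : ℕ} {r : ℚ} → 0 < L → r ℚ.* ℕ→ℚ L ≡ ℕ→ℚ p → ℕ→ℚ w ℚ.< r → w * L < p
exponent>⇒length> w {suc l} {p} {r} _ r*L≡p w<r = ℕ→ℚ′-cancel-< (subst₂ ℚ._<_ (ℕ→ℚ′-* w (suc l)) r*L′≡p′ w*L<r*L)
  where
  r*L′≡p′ : r ℚ.* ℕ→ℚ′ (suc l) ≡ ℕ→ℚ′ p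
  r*L′≡p′ = trans (cong (r ℚ.*_) (sym (ℕ→ℚ≡ℕ→ℚ′ (suc l)))) (trans r*L≡p (ℕ→ℚ≡ℕ→ℚ′ p))
  w*L<r*L : ℕ→ℚ′ w ℚ.* ℕ→ℚ′ (suc l) ℚ.< r ℚ.* ℕ→ℚ′ (suc l)
  w*L<r*L = ℚ.*-monoˡ-<-pos (ℕ→ℚ′ (suc l)) (subst (ℚ._< r) (ℕ→ℚ≡ℕ→ℚ′ w) w<r)

isPowerOf⇒length> : ∀ {A : Set} w {u v : List A} {r} → IsPowerOf u v r → ℕ→ℚ w ℚ.< r → w * length v < length u
isPowerOf⇒length> w {v = v} (v≢[] , p , r*|v|≡p , u≡) w<r =
  subst (w * length v <_) (sym (trans (cong length u≡) (length-prefixPow v p (length>0 v≢[]))))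
        (exponent>⇒length> w (length>0 v≢[]) r*|v|≡p w<r)

isPowerOf⇒hasPeriod : ∀ {A : Set} {u v : List A} {r} → IsPowerOf u v r → HasPeriod u (length v)
isPowerOf⇒hasPeriod {v = v} (_ , p , _ , u≡) = subst (λ u → HasPeriod u (length v)) (sym u≡) (prefixPow-hasPeriod v p)

ℕ→ℚ-unbounded : ∀ (q : ℚ) → ∃ λ M → q ℚ.< ℕ→ℚ M
ℕ→ℚ-unbounded q@(mkℚ (ℤ.+ a) den _) = suc a , subst (q ℚ.<_) (sym (ℕ→ℚ≡ℕ→ℚ′ (suc a)))
  (*<* (subst (ℤ._< ℤ.+ (suc a * suc den)) (sym (ℤ.*-identityʳ (ℤ.+ a))) (+<+ (m≤m*n (suc a) (suc den)))))
ℕ→ℚ-unbounded q@(mkℚ ℤ.-[1+ a ] den _) = 1 , subst (q ℚ.<_) (sym (ℕ→ℚ≡ℕ→ℚ′ 1))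
  (*<* (subst (ℤ._< ℤ.+ (1 * suc den)) (sym (ℤ.*-identityʳ ℤ.-[1+ a ])) ℤ.-<+))

exponent-above : ∀ {L p : ℕ} (M : ℕ) → 0 < L → M * L ≤ p → ∀ {q} → q ℚ.< ℕ→ℚ M →
                 ∃ λ r → r ℚ.* ℕ→ℚ L ≡ ℕ→ℚ p × q ℚ.< r
exponent-above {suc l} {p} M _ M*L≤p {q} q<M =
  r , trans (cong (r ℚ.*_) (ℕ→ℚ≡ℕ→ℚ′ (suc l))) (trans r*L≡p (sym (ℕ→ℚ≡ℕ→ℚ′ p))) ,
  ℚ.<-≤-trans q<M (subst (ℚ._≤ r) (sym (ℕ→ℚ≡ℕ→ℚ′ M)) M≤r)
  where
  L = ℕ→ℚ′ (suc l)
  r = ℕ→ℚ′ p ℚ.* ℚ.1/ L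
  r*L≡p : r ℚ.* L ≡ ℕ→ℚ′ p
  r*L≡p = trans (ℚ.*-assoc (ℕ→ℚ′ p) (ℚ.1/ L) L)
                (trans (cong (ℕ→ℚ′ p ℚ.*_) (ℚ.*-inverseˡ L)) (ℚ.*-identityʳ (ℕ→ℚ′ p)))
  M≤r : ℕ→ℚ′ M ℚ.≤ r
  M≤r = ℚ.*-cancelʳ-≤-pos L (subst₂ ℚ._≤_ (sym (ℕ→ℚ′-* M (suc l))) (sym r*L≡p) (ℕ→ℚ′-mono-≤ M*L≤p))

-- Condition 2 implies condition 3

module _ {X A : Set} {h : Morphism X A} (inj : InjectiveMorphism h) where

  injective⇒nonErasing : ∀ z → 0 < length (h z)
  injective⇒nonErasing z with h z in hz≡
  ... | _ ∷ _ = s≤s z≤n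
  ... | []    with inj [ z ] [] (trans (cong (_++ []) hz≡) refl)
  ...   | ()

  injective⇒noncommuting : ∀ {x y} → x ≢ y → h x ++ h y ≢ h y ++ h x
  injective⇒noncommuting {x} {y} x≢y hxy≡hyx = x≢y (∷-injectiveˡ (inj (x ∷ [ y ]) (y ∷ [ x ]) (begin
      h x ++ h y ++ []  ≡⟨ cong (h x ++_) (++-identityʳ (h y)) ⟩
      h x ++ h y        ≡⟨ hxy≡hyx ⟩
      h y ++ h x        ≡⟨ cong (h y ++_) (++-identityʳ (h x)) ⟨
      h y ++ h x ++ []  ∎)))
    where open ≡-Reasoning

  shortPeriod⇒hasShape : ∀ {x y} → x ≢ y → ∀ w → w ≢ [] → All (BinaryWords.InXY x y) w →
                         ∀ {d} → 0 < d → HasPeriod (apply h w) d → d ≤ length (h x) → HasShape x y w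
  shortPeriod⇒hasShape {x} {y} x≢y w w≢[] xy-w d>0 P d≤hx with BinaryWords.hasShape-or-twoGaps x y w w≢[] xy-w
  ... | inj₁ shape = shape
  ... | inj₂ (i , k , (p₁ , s₁ , w≡₁) , (p₂ , s₂ , w≡₂)) =
    ⊥-elim (twoGaps⇒noPeriod≤ (h x) (h y) i k (injective⇒noncommuting x≢y) (injective⇒nonErasing y) o₁ o₂ d>0 P d≤hx)
    where
    open BinaryWords x y using (y^)
    o₁ : OccursAt (apply h w) (length (apply h p₁)) (h x ++ h y ^ i ++ h x)
    o₁ = subst (λ u → OccursAt u _ _) (sym (begin
        apply h w                                               ≡⟨ cong (apply h) w≡₁ ⟩
        apply h (p₁ ++ x ∷ y^ i ++ x ∷ s₁)                      ≡⟨ apply-factor h p₁ x (y^ i) x s₁ ⟩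
        apply h p₁ ++ (h x ++ apply h (y^ i) ++ h x) ++ apply h s₁ ≡⟨ cong (λ q → apply h p₁ ++ (h x ++ q ++ h x) ++ apply h s₁) (apply-replicate h i y) ⟩
        apply h p₁ ++ (h x ++ h y ^ i ++ h x) ++ apply h s₁     ∎))
      (occursAt-middle (apply h p₁) _ (apply h s₁))
      where open ≡-Reasoning
    o₂ : OccursAt (apply h w) (length (apply h p₂)) (h x ++ h y ^ i ++ h y ++ h y ^ k ++ h x)
    o₂ = subst (λ u → OccursAt u _ _) (sym (begin
        apply h w                                                         ≡⟨ cong (apply h) w≡₂ ⟩
        apply h (p₂ ++ x ∷ (y^ i ++ y ∷ y^ k) ++ x ∷ s₂)                  ≡⟨ apply-factor h p₂ x (y^ i ++ y ∷ y^ k) x s₂ ⟩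
        apply h p₂ ++ (h x ++ apply h (y^ i ++ y ∷ y^ k) ++ h x) ++ apply h s₂
          ≡⟨ cong (λ q → apply h p₂ ++ (h x ++ q) ++ apply h s₂) gaps ⟩
        apply h p₂ ++ (h x ++ h y ^ i ++ h y ++ h y ^ k ++ h x) ++ apply h s₂ ∎))
      (occursAt-middle (apply h p₂) _ (apply h s₂))
      where
      open ≡-Reasoning
      gaps : apply h (y^ i ++ y ∷ y^ k) ++ h x ≡ h y ^ i ++ h y ++ h y ^ k ++ h x
      gaps = begin
        apply h (y^ i ++ y ∷ y^ k) ++ h x             ≡⟨ cong (_++ h x) (concatMap-++ h (y^ i) _) ⟩
        (apply h (y^ i) ++ h y ++ apply h (y^ k)) ++ h x
          ≡⟨ cong₂ (λ a b → (a ++ h y ++ b) ++ h x) (apply-replicate h i y) (apply-replicate h k y) ⟩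
        (h y ^ i ++ h y ++ h y ^ k) ++ h x             ≡⟨ ++-assoc (h y ^ i) _ _ ⟩
        h y ^ i ++ (h y ++ h y ^ k) ++ h x             ≡⟨ cong (h y ^ i ++_) (++-assoc (h y) _ _) ⟩
        h y ^ i ++ h y ++ h y ^ k ++ h x               ∎

-- Some letter of w is mapped to a word at least as long as the period |v| of h(w),
-- because |h(w)| > |w| |v|; the other letter is handled by symmetry.
EIGreaterLength⇒HasShape : ∀ {n m} {a b : Fin n} → a ≢ b → ∀ w → w ≢ [] →
                           All (λ x → x ≡ a ⊎ x ≡ b) w → EIGreaterLength m w → HasShape a b w
EIGreaterLength⇒HasShape {a = a} {b} a≢b w w≢[] ab-w (h , inj , v , r , v^r@(v≢[] , _) , |w|<r)
  with length v ≤? length (h a) | length v ≤? length (h b)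
... | yes |v|≤ha | _ = shortPeriod⇒hasShape inj a≢b w w≢[] ab-w (length>0 v≢[]) (isPowerOf⇒hasPeriod {r = r} v^r) |v|≤ha
... | no _ | yes |v|≤hb = HasShape-swap (shortPeriod⇒hasShape inj (a≢b ∘ sym) w w≢[] (All.map [ inj₂ , inj₁ ]′ ab-w)
                                                               (length>0 v≢[]) (isPowerOf⇒hasPeriod {r = r} v^r) |v|≤hb)
... | no |v|≰ha | no |v|≰hb = ⊥-elim (<⇒≱ (isPowerOf⇒length> (length w) v^r |w|<r) |h-w|≤|w||v|)
  where
  |h-w|≤|w||v| : length (apply h w) ≤ length w * length v
  |h-w|≤|w||v| = length-apply≤ h w (All.map (λ { (inj₁ refl) → <⇒≤ (≰⇒> |v|≰ha) ; (inj₂ refl) → <⇒≤ (≰⇒> |v|≰hb) }) ab-w)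

-- Condition 3 implies condition 1

module Construction {n m′ : ℕ} {x y : Fin n} (x≢y : x ≢ y) (k j₁ j₂ j₃ N : ℕ) where

  𝟘 𝟙 : Fin (2 + m′)
  𝟘 = zero
  𝟙 = suc zero

  𝟘^ : ℕ → List (Fin (2 + m′))
  𝟘^ a = replicate a 𝟘

  -- t + j₂ = T, so that a block h(x y^j₂) followed by 0^T closes up to a copy of Y.
  T t : ℕ
  T = suc (j₁ + j₂ + j₃)
  t = suc (j₁ + j₃)

  Y : List (Fin (2 + m′))
  Y = 𝟙 ∷ 𝟘^ (T + T)

  lastLetter : Bool → Fin (2 + m′)
  lastLetter false = 𝟘
  lastLetter true  = 𝟙

  body : Bool → List (Fin (2 + m′))
  body false = []
  body true  = 𝟘^ T ++ Y ^ N

  φ : Morphism Bool (Fin (2 + m′))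
  φ b = body b ∷ʳ lastLetter b

  φ-injective : InjectiveMorphism φ
  φ-injective = suffixCode⇒injective φ φ≢[] φ-suffixFree
    where
    φ≢[] : ∀ b → φ b ≢ []
    φ≢[] b e with () ← ++-conicalʳ (body b) [ lastLetter b ] e
    lastLetter-injective : ∀ {b b′} → lastLetter b ≡ lastLetter b′ → b ≡ b′
    lastLetter-injective {false} {false} _ = refl
    lastLetter-injective {true}  {true}  _ = refl
    φ-suffixFree : SuffixFree φ
    φ-suffixFree b b′ s e = lastLetter-injective
      (∷ʳ-injectiveʳ (s ++ body b) (body b′) (trans (++-assoc s (body b) _) e))

  data Codeword (z : Fin n) : List Bool → Set where
    for-y : z ≡ y → Codeword z [ false ]
    for-x : z ≡ x → Codeword z (true ∷ replicate t false)
    other : z ≢ y → z ≢ x → Codeword z (true ∷ true ∷ replicate (toℕ z) true ++ [ false ])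

  g : Morphism (Fin n) Bool
  g z with z ≟ᶠ y | z ≟ᶠ x
  ... | yes _ | _     = [ false ]
  ... | no  _ | yes _ = true ∷ replicate t false
  ... | no  _ | no  _ = true ∷ true ∷ replicate (toℕ z) true ++ [ false ]

  codeword : ∀ z → Codeword z (g z)
  codeword z with z ≟ᶠ y | z ≟ᶠ x
  ... | yes z≡y | _       = for-y z≡y
  ... | no  z≢y | yes z≡x = for-x z≡x
  ... | no  z≢y | no  z≢x = other z≢y z≢x

  g-y : g y ≡ [ false ]
  g-y with g y | codeword y
  ... | _ | for-y _       = refl
  ... | _ | for-x y≡x     = ⊥-elim (x≢y (sym y≡x))
  ... | _ | other y≢y _   = ⊥-elim (y≢y refl)

  g-x : g x ≡ true ∷ replicate t false
  g-x with g x | codeword x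
  ... | _ | for-y x≡y     = ⊥-elim (x≢y x≡y)
  ... | _ | for-x _       = refl
  ... | _ | other _ x≢x   = ⊥-elim (x≢x refl)

  g-injective : InjectiveMorphism g
  g-injective = prefixCode⇒injective g g≢[] g-prefixFree
    where
    g≢[] : ∀ z → g z ≢ []
    g≢[] z with g z | codeword z
    ... | _ | for-y _   = λ ()
    ... | _ | for-x _   = λ ()
    ... | _ | other _ _ = λ ()
    trues-injective : ∀ a b s → (replicate a true ++ [ false ]) ++ s ≡ replicate b true ++ [ false ] → a ≡ b
    trues-injective zero    zero    s _ = refl
    trues-injective (suc a) (suc b) s e = cong suc (trues-injective a b s (∷-injectiveʳ e))
    g-prefixFree : PrefixFree g
    g-prefixFree z z′ s with g z | codeword z | g z′ | codeword z′
    ... | _ | for-y z≡y   | _ | for-y z′≡y = λ _ → trans z≡y (sym z′≡y)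
    ... | _ | for-x z≡x   | _ | for-x z′≡x = λ _ → trans z≡x (sym z′≡x)
    ... | _ | other _ _   | _ | other _ _  = λ e →
      toℕ-injective (trues-injective (toℕ z) (toℕ z′) s (∷-injectiveʳ (∷-injectiveʳ e)))
    ... | _ | for-y _     | _ | for-x _    = λ ()
    ... | _ | for-y _     | _ | other _ _  = λ ()
    ... | _ | for-x _     | _ | for-y _    = λ ()
    ... | _ | for-x _     | _ | other _ _  = λ ()
    ... | _ | other _ _   | _ | for-y _    = λ ()
    ... | _ | other _ _   | _ | for-x _    = λ ()

  h : Morphism (Fin n) (Fin (2 + m′))
  h = apply φ ∘ g

  h-injective : InjectiveMorphism h
  h-injective = injective-∘ φ-injective g-injective

  H : List (Fin (2 + m′))
  H = φ true ++ 𝟘^ t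

  h-y^ : ∀ j → apply h (replicate j y) ≡ 𝟘^ j
  h-y^ j = trans (apply-replicate h j y) (trans (cong (λ b → apply φ b ^ j) g-y) (singleton-^ 𝟘 j))

  h-x : h x ≡ H
  h-x = trans (cong (apply φ) g-x) (cong (φ true ++_) (trans (apply-replicate φ t false) (singleton-^ 𝟘 t)))

  w : List (Fin n)
  w = shape y x k j₁ j₂ j₃

  h-w : apply h w ≡ 𝟘^ j₁ ++ (H ++ 𝟘^ j₂) ^ k ++ H ++ 𝟘^ j₃
  h-w = begin
      apply h (replicate j₁ y ++ (x ∷ replicate j₂ y) ^ k ++ x ∷ replicate j₃ y)
        ≡⟨ concatMap-++ h (replicate j₁ y) _ ⟩
      apply h (replicate j₁ y) ++ apply h ((x ∷ replicate j₂ y) ^ k ++ x ∷ replicate j₃ y)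
        ≡⟨ cong (apply h (replicate j₁ y) ++_) (concatMap-++ h ((x ∷ replicate j₂ y) ^ k) _) ⟩
      apply h (replicate j₁ y) ++ apply h ((x ∷ replicate j₂ y) ^ k) ++ h x ++ apply h (replicate j₃ y)
        ≡⟨ cong₂ _++_ (h-y^ j₁) (cong₂ _++_ (trans (apply-^ h (x ∷ replicate j₂ y) k) (cong (_^ k) (cong₂ _++_ h-x (h-y^ j₂))))
                                            (cong₂ _++_ h-x (h-y^ j₃))) ⟩
      𝟘^ j₁ ++ (H ++ 𝟘^ j₂) ^ k ++ H ++ 𝟘^ j₃
        ∎
    where open ≡-Reasoning

  H≡ : H ≡ 𝟘^ T ++ Y ^ N ++ 𝟙 ∷ 𝟘^ t
  H≡ = trans (++-assoc (𝟘^ T ++ Y ^ N) [ 𝟙 ] (𝟘^ t)) (++-assoc (𝟘^ T) (Y ^ N) _)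

  t+j₂≡T : t + j₂ ≡ T
  t+j₂≡T = lemma j₁ j₂ j₃
    where
    lemma : ∀ a b c → suc (a + c) + b ≡ suc (a + b + c)
    lemma = solve-∀

  block-closes : ∀ R → (H ++ 𝟘^ j₂) ++ 𝟘^ T ++ R ≡ 𝟘^ T ++ Y ^ N ++ Y ++ R
  block-closes R = begin
      (H ++ 𝟘^ j₂) ++ 𝟘^ T ++ R                          ≡⟨ ++-assoc H (𝟘^ j₂) _ ⟩
      H ++ 𝟘^ j₂ ++ 𝟘^ T ++ R                            ≡⟨ cong (_++ 𝟘^ j₂ ++ 𝟘^ T ++ R) H≡ ⟩
      (𝟘^ T ++ Y ^ N ++ 𝟙 ∷ 𝟘^ t) ++ 𝟘^ j₂ ++ 𝟘^ T ++ R  ≡⟨ ++-assoc (𝟘^ T) _ _ ⟩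
      𝟘^ T ++ (Y ^ N ++ 𝟙 ∷ 𝟘^ t) ++ 𝟘^ j₂ ++ 𝟘^ T ++ R  ≡⟨ cong (𝟘^ T ++_) (++-assoc (Y ^ N) _ _) ⟩
      𝟘^ T ++ Y ^ N ++ 𝟙 ∷ 𝟘^ t ++ 𝟘^ j₂ ++ 𝟘^ T ++ R    ≡⟨ cong (λ z → 𝟘^ T ++ Y ^ N ++ 𝟙 ∷ z) zeros ⟩
      𝟘^ T ++ Y ^ N ++ Y ++ R                            ∎
    where
    open ≡-Reasoning
    zeros : 𝟘^ t ++ 𝟘^ j₂ ++ 𝟘^ T ++ R ≡ 𝟘^ (T + T) ++ R
    zeros = begin
      𝟘^ t ++ 𝟘^ j₂ ++ 𝟘^ T ++ R   ≡⟨ replicate-+-++ 𝟘 t j₂ _ ⟩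
      𝟘^ (t + j₂) ++ 𝟘^ T ++ R     ≡⟨ cong (λ a → 𝟘^ a ++ 𝟘^ T ++ R) t+j₂≡T ⟩
      𝟘^ T ++ 𝟘^ T ++ R            ≡⟨ replicate-+-++ 𝟘 T T R ⟩
      𝟘^ (T + T) ++ R              ∎

  blocks : ∀ k′ → ∃ λ K → N ≤ K × (H ++ 𝟘^ j₂) ^ k′ ++ H ≡ 𝟘^ T ++ Y ^ K ++ 𝟙 ∷ 𝟘^ t
  blocks zero      = N , ≤-refl , H≡
  blocks (suc k′) with blocks k′
  ... | K , N≤K , eq = N + suc K , m≤m+n N (suc K) , (begin
      ((H ++ 𝟘^ j₂) ++ (H ++ 𝟘^ j₂) ^ k′) ++ H     ≡⟨ ++-assoc (H ++ 𝟘^ j₂) _ H ⟩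
      (H ++ 𝟘^ j₂) ++ (H ++ 𝟘^ j₂) ^ k′ ++ H       ≡⟨ cong ((H ++ 𝟘^ j₂) ++_) eq ⟩
      (H ++ 𝟘^ j₂) ++ 𝟘^ T ++ Y ^ K ++ tl           ≡⟨ block-closes (Y ^ K ++ tl) ⟩
      𝟘^ T ++ Y ^ N ++ Y ++ Y ^ K ++ tl             ≡⟨ cong (λ z → 𝟘^ T ++ Y ^ N ++ z) (++-assoc Y (Y ^ K) tl) ⟨
      𝟘^ T ++ Y ^ N ++ Y ^ suc K ++ tl              ≡⟨ cong (𝟘^ T ++_) (++-assoc (Y ^ N) _ tl) ⟨
      𝟘^ T ++ (Y ^ N ++ Y ^ suc K) ++ tl            ≡⟨ cong (λ z → 𝟘^ T ++ z ++ tl) (^-+ Y N (suc K)) ⟨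
      𝟘^ T ++ Y ^ (N + suc K) ++ tl                 ∎)
    where
    open ≡-Reasoning
    tl = 𝟙 ∷ 𝟘^ t

  K : ℕ
  K = proj₁ (blocks k)

  -- h(w) is a prefix of v^ω for v = 0^(j₁+T) 1 0^(1+j₂+j₃), a rotation of Y.
  Pw Qw v : List (Fin (2 + m′))
  Pw = 𝟘^ (j₁ + T)
  Qw = 𝟘^ (suc (j₂ + j₃))
  v  = Pw ++ 𝟙 ∷ Qw

  Y≡ : Y ≡ 𝟙 ∷ Qw ++ Pw
  Y≡ = cong (𝟙 ∷_) (trans (cong 𝟘^ (lemma j₁ j₂ j₃)) (sym (replicate-+ 𝟘 (suc (j₂ + j₃)) (j₁ + T))))
    where
    lemma : ∀ a b c → suc (a + b + c) + suc (a + b + c) ≡ suc (b + c) + (a + suc (a + b + c))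
    lemma = solve-∀

  h-w≡ : apply h w ≡ v ^ K ++ Pw ++ 𝟙 ∷ 𝟘^ (t + j₃)
  h-w≡ = begin
      apply h w                                               ≡⟨ h-w ⟩
      𝟘^ j₁ ++ (H ++ 𝟘^ j₂) ^ k ++ H ++ 𝟘^ j₃                 ≡⟨ cong (𝟘^ j₁ ++_) (++-assoc ((H ++ 𝟘^ j₂) ^ k) H (𝟘^ j₃)) ⟨
      𝟘^ j₁ ++ ((H ++ 𝟘^ j₂) ^ k ++ H) ++ 𝟘^ j₃               ≡⟨ cong (λ z → 𝟘^ j₁ ++ z ++ 𝟘^ j₃) (proj₂ (proj₂ (blocks k))) ⟩
      𝟘^ j₁ ++ (𝟘^ T ++ Y ^ K ++ 𝟙 ∷ 𝟘^ t) ++ 𝟘^ j₃           ≡⟨ cong (𝟘^ j₁ ++_) (++-assoc (𝟘^ T) _ _) ⟩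
      𝟘^ j₁ ++ 𝟘^ T ++ (Y ^ K ++ 𝟙 ∷ 𝟘^ t) ++ 𝟘^ j₃           ≡⟨ replicate-+-++ 𝟘 j₁ T _ ⟩
      Pw ++ (Y ^ K ++ 𝟙 ∷ 𝟘^ t) ++ 𝟘^ j₃                      ≡⟨ cong (Pw ++_) (++-assoc (Y ^ K) _ _) ⟩
      Pw ++ Y ^ K ++ 𝟙 ∷ 𝟘^ t ++ 𝟘^ j₃                        ≡⟨ cong (λ z → Pw ++ Y ^ K ++ 𝟙 ∷ z) (replicate-+ 𝟘 t j₃) ⟩
      Pw ++ Y ^ K ++ 𝟙 ∷ 𝟘^ (t + j₃)                          ≡⟨ ++-assoc Pw (Y ^ K) _ ⟨
      (Pw ++ Y ^ K) ++ 𝟙 ∷ 𝟘^ (t + j₃)                        ≡⟨ cong (λ z → (Pw ++ z ^ K) ++ 𝟙 ∷ 𝟘^ (t + j₃)) Y≡ ⟩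
      (Pw ++ (𝟙 ∷ Qw ++ Pw) ^ K) ++ 𝟙 ∷ 𝟘^ (t + j₃)           ≡⟨ cong (_++ 𝟙 ∷ 𝟘^ (t + j₃)) (^-rotate Pw (𝟙 ∷ Qw) K) ⟩
      (v ^ K ++ Pw) ++ 𝟙 ∷ 𝟘^ (t + j₃)                        ≡⟨ ++-assoc (v ^ K) Pw _ ⟩
      v ^ K ++ Pw ++ 𝟙 ∷ 𝟘^ (t + j₃)                          ∎
    where open ≡-Reasoning

  h-w-prefix : apply h w ++ 𝟘^ (suc (j₁ + j₂ + j₂)) ++ 𝟙 ∷ Qw ≡ v ^ (K + 2)
  h-w-prefix = begin
      apply h w ++ R                                   ≡⟨ cong (_++ R) h-w≡ ⟩
      (v ^ K ++ Pw ++ 𝟙 ∷ 𝟘^ (t + j₃)) ++ R            ≡⟨ ++-assoc (v ^ K) _ R ⟩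
      v ^ K ++ (Pw ++ 𝟙 ∷ 𝟘^ (t + j₃)) ++ R            ≡⟨ cong (v ^ K ++_) (++-assoc Pw _ R) ⟩
      v ^ K ++ Pw ++ 𝟙 ∷ 𝟘^ (t + j₃) ++ R              ≡⟨ cong (λ z → v ^ K ++ Pw ++ 𝟙 ∷ z) zeros ⟩
      v ^ K ++ Pw ++ 𝟙 ∷ Qw ++ v                       ≡⟨ cong (v ^ K ++_) (++-assoc Pw (𝟙 ∷ Qw) v) ⟨
      v ^ K ++ v ++ v                                  ≡⟨ cong (λ z → v ^ K ++ v ++ z) (++-identityʳ v) ⟨
      v ^ K ++ v ^ 2                                   ≡⟨ ^-+ v K 2 ⟨
      v ^ (K + 2)                                      ∎
    where
    open ≡-Reasoning
    R = 𝟘^ (suc (j₁ + j₂ + j₂)) ++ 𝟙 ∷ Qw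
    lemma : ∀ a b c → suc (a + c) + c + suc (a + b + b) ≡ suc (b + c) + (a + suc (a + b + c))
    lemma = solve-∀
    zeros : 𝟘^ (t + j₃) ++ R ≡ Qw ++ v
    zeros = begin
      𝟘^ (t + j₃) ++ R                        ≡⟨ replicate-+-++ 𝟘 (t + j₃) _ _ ⟩
      𝟘^ (t + j₃ + suc (j₁ + j₂ + j₂)) ++ 𝟙 ∷ Qw ≡⟨ cong (λ a → 𝟘^ a ++ 𝟙 ∷ Qw) (lemma j₁ j₂ j₃) ⟩
      𝟘^ (suc (j₂ + j₃) + (j₁ + T)) ++ 𝟙 ∷ Qw   ≡⟨ replicate-+-++ 𝟘 (suc (j₂ + j₃)) (j₁ + T) _ ⟨
      Qw ++ v                                  ∎

  v≢[] : v ≢ []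
  v≢[] v≡[] with () ← ++-conicalʳ Pw (𝟙 ∷ Qw) v≡[]


  N|v|≤|h-w| : N * length v ≤ length (apply h w)
  N|v|≤|h-w| = ≤-trans (*-monoˡ-≤ (length v) (proj₁ (proj₂ (blocks k))))
                 (subst (_≤ length (apply h w)) (length-^ v K) |vᴷ|≤|h-w|)
    where
    |vᴷ|≤|h-w| : length (v ^ K) ≤ length (apply h w)
    |vᴷ|≤|h-w| = subst (length (v ^ K) ≤_) (sym (trans (cong length h-w≡) (length-++ (v ^ K))))
                   (m≤m+n (length (v ^ K)) (length (Pw ++ 𝟙 ∷ 𝟘^ (t + j₃))))

  h-w-exponent> : ∀ {q} → q ℚ.< ℕ→ℚ N → ExpGreater (apply h w) q
  h-w-exponent> q<N with exponent-above N (length>0 v≢[]) N|v|≤|h-w| q<N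
  ... | r , r*|v|≡|h-w| , q<r =
    v , r , (v≢[] , length (apply h w) , r*|v|≡|h-w| ,
             sym (prefix-of-^⇒prefixPow v (length>0 v≢[]) (apply h w) _ (K + 2) h-w-prefix)) , q<r

shape⇒EIInfinite : ∀ {n m′} {x y : Fin n} → x ≢ y → ∀ k j₁ j₂ j₃ → EIInfinite (2 + m′) (shape y x k j₁ j₂ j₃)
shape⇒EIInfinite x≢y k j₁ j₂ j₃ q with ℕ→ℚ-unbounded q
... | N , q<N = h , h-injective , h-w-exponent> q<N
  where open Construction x≢y k j₁ j₂ j₃ N

mainTheorem2 : (n m : ℕ) → 2 ≤ n → 2 ≤ m → (a b : Fin n) → a ≢ b →
    (w : List (Fin n)) → w ≢ [] → All (λ x → (x ≡ a) ⊎ (x ≡ b)) w →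
    ((EIInfinite m w ⇔ EIGreaterLength m w) × (EIGreaterLength m w ⇔ HasShape a b w))
mainTheorem2 n (suc (suc m′)) _ (s≤s (s≤s _)) a b a≢b w w≢[] ab-w =
  mk⇔ infinite⇒>length (shape⇒infinite ∘ >length⇒shape) , mk⇔ >length⇒shape (infinite⇒>length ∘ shape⇒infinite)
  where
  infinite⇒>length : EIInfinite (2 + m′) w → EIGreaterLength (2 + m′) w
  infinite⇒>length unbounded = unbounded (ℕ→ℚ (length w))
  >length⇒shape : EIGreaterLength (2 + m′) w → HasShape a b w
  >length⇒shape = EIGreaterLength⇒HasShape a≢b w w≢[] ab-w
  shape⇒infinite : HasShape a b w → EIInfinite (2 + m′) w
  shape⇒infinite (k , j₁ , j₂ , j₃ , inj₁ w≡) = subst (EIInfinite _) (sym w≡) (shape⇒EIInfinite a≢b k j₁ j₂ j₃)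
  shape⇒infinite (k , j₁ , j₂ , j₃ , inj₂ w≡) = subst (EIInfinite _) (sym w≡) (shape⇒EIInfinite (a≢b ∘ sym) k j₁ j₂ j₃)
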